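{- Let $(x_0,y_0),(x_1,y_1),\dots$ be the solutions in $\mathbb{N}$ of $x^2-19\,y^2=1$, listed so that $y_0<y_1<\cdots$ (so $x_1=170$, $y_1=39$); $39$ divides every $y_k$. Call a positive integer representable if it can be written as $w^2+w\,t+5\,t^2$ with $w,t\in\mathbb{Z}$. Suppose that $y_n/39$ is representable for some integer $n>0$ that is not a power of $2$. Then the equation \[ 19\cdot 3^2\cdot\left(r^2+r\,s+5\,s^2\right)^2-13^2\cdot\left(v^2+v\,u+5\,u^2\right)^2=2 \] has a solution $\bar r,\bar s,\bar v,\bar u\in\mathbb{Z}$ such that $\bar r\neq\pm1$ or $\bar s\neq 0$, and moreover $39\,(\bar r^2+\bar r\,\bar s+5\,\bar s^2)\,(\bar v^2+\bar v\,\bar u+5\,\bar u^2)$ divides $y_n$. -}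

module Defs where

open import Data.Nat as ℕ using (ℕ; _<_)
open import Data.Integer as ℤ using (ℤ; +_; _+_; _*_; _-_)
open import Data.Product using (∃; ∃-syntax; _×_)
open import Relation.Binary.PropositionalEquality using (_≡_)

Q : ℤ → ℤ → ℤ
Q w t = w * w + w * t + + 5 * (t * t)

Representable : ℕ → Set
Representable m = 0 < m × ∃[ w ] ∃[ t ] (+ m ≡ Q w t)

PellSol : ℕ → ℕ → Set
PellSol x y = x ℕ.* x ≡ 1 ℕ.+ 19 ℕ.* (y ℕ.* y)

IsPellEnumeration : (ℕ → ℕ) → (ℕ → ℕ) → Set
IsPellEnumeration X Y =
  (∀ k → PellSol (X k) (Y k)) ×
  (∀ k → Y k < Y (ℕ.suc k)) ×
  (∀ x y → PellSol x y → ∃[ k ] (x ≡ X k × y ≡ Y k))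

IsPowerOf2 : ℕ → Set
IsPowerOf2 n = ∃[ k ] (n ≡ 2 ℕ.^ k)

-- The fundamental solution of x² - 19 y² = 1 is ε = 170 + 39 √19 = (13 + 3 √19)² / 2, so the
-- solutions are x k + y k √19 = ε ^ k, and (13 B k + 3 A k √19)² = 2 ε ^ (2k+1) for
-- 13 B k + 3 A k √19 = (13 + 3 √19) ε ^ k.  Hence y (2k+1) = 39 A k B k and 171 A k² - 169 B k² = 2.
-- Write n = 2 ^ e (2k+1); k > 0 as n is not a power of 2.  The doubling formula y (2j) = 2 x j y j
-- gives y n = 39 A k B k R, where A k and B k are coprime to each other and to R.  The form
-- w² + w t + 5 t² has discriminant -19 and class number one, so a factor of one of its values
-- that is coprime to the cofactor is again a value.  So A k = Q r s, B k = Q v u, and A k > 1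
-- rules out r = ±1, s = 0.

module Submission where

open import Defs
open import Data.Nat as ℕ using (ℕ; zero; suc; _<_; _/_)
import Data.Nat.Properties as ℕP
import Data.Nat.Divisibility as ℕD
open import Data.Nat.Coprimality as Coprimality using (Coprime; coprime-divisor)
open import Data.Nat.Induction using (<-rec)
open import Data.Product using (∃; ∃-syntax; _×_; _,_; proj₁; proj₂)
open import Data.Sum using (_⊎_; inj₁; inj₂)
open import Data.Empty using (⊥-elim)
open import Relation.Nullary using (¬_; yes; no; contradiction)
open import Relation.Binary.PropositionalEquality
open import Algebra.Properties.CommutativeSemigroup ℕP.*-commutativeSemigroup using (xy∙z≈xz∙y; x∙yz≈y∙xz)

coprime-* : ∀ {a b c} → Coprime a b → Coprime a c → Coprime a (b ℕ.* c)
coprime-* coprime-ab coprime-ac (d∣a , d∣bc) =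
  coprime-ac (d∣a , coprime-divisor (λ (e∣d , e∣b) → coprime-ab (ℕD.∣-trans e∣d d∣a , e∣b)) d∣bc)

module QuadraticForm where

  open import Data.Nat using (z≤n; s≤s)
  open import Data.Nat.Divisibility using (divides)
  open import Data.Nat.GCD using (gcd; gcd[m,n]∣m; gcd[m,n]∣n; gcd-greatest; module Bézout)
  open Coprimality using (coprime-Bézout)
  open import Data.Integer as ℤ using (ℤ; +_; -[1+_]; -_; _+_; _*_; _-_; _⊖_; ∣_∣)
  import Data.Integer.Properties as ℤP
  open import Data.Integer.Divisibility.Signed using (∣ᵤ⇒∣; module _∣_)
  open import Data.Integer.DivMod using (_/ℕ_; _%ℕ_; n%ℕd<d; a≡a%ℕn+[a/ℕn]*n)
  open import Data.Integer.Tactic.RingSolver using (solve-∀)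
  open import Relation.Nullary.Decidable using (from-no)

  form : ℤ → ℤ → ℤ → ℤ → ℤ → ℤ
  form a b c x y = a * (x * x) + b * (x * y) + c * (y * y)

  discriminant : ℤ → ℤ → ℤ → ℤ
  discriminant a b c = b * b - + 4 * a * c

  ValueOfQ : ℤ → Set
  ValueOfQ m = ∃[ w ] ∃[ t ] (m ≡ Q w t)

  ValuesOfQ : ℤ → ℤ → ℤ → Set
  ValuesOfQ a b c = ∀ x y → ValueOfQ (form a b c x y)

  valuesOfQ-translate : ∀ a b c q →
    ValuesOfQ a (b + + 2 * a * q) (a * (q * q) + b * q + c) → ValuesOfQ a b c
  valuesOfQ-translate a b c q values x y =
    subst ValueOfQ (substitution a b c q x y) (values (x - q * y) y)
    where
    substitution : ∀ a b c q x y →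
      a * ((x - q * y) * (x - q * y)) + (b + + 2 * a * q) * ((x - q * y) * y)
        + (a * (q * q) + b * q + c) * (y * y)
      ≡ a * (x * x) + b * (x * y) + c * (y * y)
    substitution = solve-∀

  valuesOfQ-swap : ∀ a b c → ValuesOfQ c (- b) a → ValuesOfQ a b c
  valuesOfQ-swap a b c values x y = subst ValueOfQ (substitution a b c x y) (values y (- x))
    where
    substitution : ∀ a b c x y →
      c * (y * y) + (- b) * (y * (- x)) + a * ((- x) * (- x)) ≡ a * (x * x) + b * (x * y) + c * (y * y)
    substitution = solve-∀

  valuesOfQ-principal : ∀ b → ∣ b ∣ ≡ 1 → ValuesOfQ (+ 1) b (+ 5)
  valuesOfQ-principal (+ 1) _ x y = x , y , principal x y
    where
    principal : ∀ x y → + 1 * (x * x) + + 1 * (x * y) + + 5 * (y * y) ≡ x * x + x * y + + 5 * (y * y)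
    principal = solve-∀
  valuesOfQ-principal -[1+ 0 ] _ x y = x , - y , principal x y
    where
    principal : ∀ x y → + 1 * (x * x) + - + 1 * (x * y) + + 5 * (y * y) ≡ x * x + x * (- y) + + 5 * ((- y) * (- y))
    principal = solve-∀

  discriminant-translate : ∀ a b c q →
    discriminant a (b + + 2 * a * q) (a * (q * q) + b * q + c) ≡ discriminant a b c
  discriminant-translate a b c q = expand a b c q
    where
    expand : ∀ a b c q → (b + + 2 * a * q) * (b + + 2 * a * q) - + 4 * a * (a * (q * q) + b * q + c)
      ≡ b * b - + 4 * a * c
    expand = solve-∀

  discriminant-swap : ∀ a b c → discriminant c (- b) a ≡ discriminant a b c
  discriminant-swap a b c = expand a b c
    where
    expand : ∀ a b c → (- b) * (- b) - + 4 * c * a ≡ b * b - + 4 * a * c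
    expand = solve-∀

  ∤⇒*≢ : ∀ {m n} c → ¬ m ℕD.∣ n → m ℕ.* c ≢ n
  ∤⇒*≢ {m} c m∤n eq = m∤n (divides c (trans (sym eq) (ℕP.*-comm m c)))

  *≡suc⇒0<ʳ : ∀ m n {o} → m ℕ.* n ≡ suc o → 0 ℕ.< n
  *≡suc⇒0<ʳ m zero eq with trans (sym (ℕP.*-zeroʳ m)) eq
  ... | ()
  *≡suc⇒0<ʳ m (suc n) _ = s≤s z≤n

  -- Gauss reduction: |b| ≤ a ≤ c forces 3a² ≤ 19.
  reduced-disc-19 : ∀ a e c → 0 ℕ.< a → e ℕ.≤ a → a ℕ.≤ c →
    4 ℕ.* a ℕ.* c ≡ e ℕ.* e ℕ.+ 19 → a ≡ 1 × e ≡ 1 × c ≡ 5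
  reduced-disc-19 1 0 c _ _ _ eq = ⊥-elim (∤⇒*≢ c (from-no (4 ℕD.∣? 19)) eq)
  reduced-disc-19 1 1 c _ _ _ eq = refl , refl , ℕP.*-cancelˡ-≡ c 5 4 eq
  reduced-disc-19 1 (suc (suc e)) c _ (s≤s ()) _ _
  reduced-disc-19 2 0 c _ _ _ eq = ⊥-elim (∤⇒*≢ c (from-no (8 ℕD.∣? 19)) eq)
  reduced-disc-19 2 1 c _ _ _ eq = ⊥-elim (∤⇒*≢ c (from-no (8 ℕD.∣? 20)) eq)
  reduced-disc-19 2 2 c _ _ _ eq = ⊥-elim (∤⇒*≢ c (from-no (8 ℕD.∣? 23)) eq)
  reduced-disc-19 2 (suc (suc (suc e))) c _ (s≤s (s≤s ())) _ _
  reduced-disc-19 a@(suc (suc (suc _))) e c _ e≤a a≤c eq =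
    ⊥-elim (from-no (27 ℕ.≤? 19) (ℕP.+-cancelˡ-≤ (a ℕ.* a) 27 19 chain))
    where
    open ℕP.≤-Reasoning
    3≤a : 3 ℕ.≤ a
    3≤a = s≤s (s≤s (s≤s z≤n))
    chain : a ℕ.* a ℕ.+ 27 ℕ.≤ a ℕ.* a ℕ.+ 19
    chain = begin
      a ℕ.* a ℕ.+ 3 ℕ.* (3 ℕ.* 3) ≤⟨ ℕP.+-monoʳ-≤ (a ℕ.* a) (ℕP.*-monoʳ-≤ 3 (ℕP.*-mono-≤ 3≤a 3≤a)) ⟩
      a ℕ.* a ℕ.+ 3 ℕ.* (a ℕ.* a) ≡⟨ sym (ℕP.*-assoc 4 a a) ⟩
      4 ℕ.* a ℕ.* a              ≤⟨ ℕP.*-monoʳ-≤ (4 ℕ.* a) a≤c ⟩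
      4 ℕ.* a ℕ.* c              ≡⟨ eq ⟩
      e ℕ.* e ℕ.+ 19              ≤⟨ ℕP.+-monoˡ-≤ 19 (ℕP.*-mono-≤ e≤a e≤a) ⟩
      a ℕ.* a ℕ.+ 19              ∎

  i*i≡∣i∣*∣i∣ : ∀ i → i * i ≡ + (∣ i ∣ ℕ.* ∣ i ∣)
  i*i≡∣i∣*∣i∣ (+ n) = sym (ℤP.pos-* n n)
  i*i≡∣i∣*∣i∣ -[1+ n ] = refl

  discriminant-19⇒coefficients : ∀ a b c → 0 ℕ.< a → discriminant (+ a) b c ≡ - + 19 →
    ∃[ c' ] (c ≡ + c' × 4 ℕ.* a ℕ.* c' ≡ ∣ b ∣ ℕ.* ∣ b ∣ ℕ.+ 19)
  discriminant-19⇒coefficients a@(suc _) b c _ disc = coefficients c 4ac≡b²+19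
    where
    rearrange : ∀ X Y → Y ≡ X - (X - Y)
    rearrange = solve-∀
    4ac≡b²+19 : + 4 * + a * c ≡ + (∣ b ∣ ℕ.* ∣ b ∣ ℕ.+ 19)
    4ac≡b²+19 = begin
      + 4 * + a * c                              ≡⟨ rearrange (b * b) _ ⟩
      b * b - discriminant (+ a) b c             ≡⟨ cong₂ (λ u v → u - v) (i*i≡∣i∣*∣i∣ b) disc ⟩
      + (∣ b ∣ ℕ.* ∣ b ∣) + + 19                 ≡⟨ ℤP.pos-+ (∣ b ∣ ℕ.* ∣ b ∣) 19 ⟨
      + (∣ b ∣ ℕ.* ∣ b ∣ ℕ.+ 19)                 ∎
      where open ≡-Reasoning
    coefficients : ∀ c → + 4 * + a * c ≡ + (∣ b ∣ ℕ.* ∣ b ∣ ℕ.+ 19) →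
      ∃[ c' ] (c ≡ + c' × 4 ℕ.* a ℕ.* c' ≡ ∣ b ∣ ℕ.* ∣ b ∣ ℕ.+ 19)
    coefficients (+ c') eq = c' , refl , ℤP.+-injective (trans (ℤP.pos-* (4 ℕ.* a) c') eq)

  ∣m⊖n∣≤n : ∀ m n → m ℕ.≤ n ℕ.+ n → ∣ m ⊖ n ∣ ℕ.≤ n
  ∣m⊖n∣≤n m n m≤2n with m ℕ.≤? n
  ... | yes m≤n = ℕP.≤-trans (ℕP.≤-reflexive (ℤP.∣⊖∣-≤ m≤n)) (ℕP.m∸n≤m n m)
  ... | no m≰n = begin
    ∣ m ⊖ n ∣ ≡⟨ ℤP.∣m⊖n∣≡∣n⊖m∣ m n ⟩
    ∣ n ⊖ m ∣ ≡⟨ ℤP.∣⊖∣-≤ (ℕP.<⇒≤ (ℕP.≰⇒> m≰n)) ⟩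
    m ℕ.∸ n   ≤⟨ ℕP.m≤n+o⇒m∸n≤o m n m≤2n ⟩
    n         ∎
    where open ℕP.≤-Reasoning

  -- Division of b + a by 2a with remainder r gives the translate b - 2ak = r - a.
  centred-translate : ∀ a b → 0 ℕ.< a → ∃[ q ] ∣ b + + 2 * + a * q ∣ ℕ.≤ a
  centred-translate a@(suc _) b _ = - k , ℕP.≤-trans (ℕP.≤-reflexive (cong ∣_∣ b'≡r⊖a)) (∣m⊖n∣≤n r a r≤2a)
    where
    k : ℤ
    k = (b + + a) /ℕ (2 ℕ.* a)
    r : ℕ
    r = (b + + a) %ℕ (2 ℕ.* a)
    r≤2a : r ℕ.≤ a ℕ.+ a
    r≤2a = subst (r ℕ.≤_) (cong (a ℕ.+_) (ℕP.+-identityʳ a)) (ℕP.<⇒≤ (n%ℕd<d (b + + a) (2 ℕ.* a)))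
    shift : ∀ b a r k → b + a ≡ r + k * (+ 2 * a) → b + + 2 * a * (- k) ≡ r - a
    shift b a r k eq = begin
      b + + 2 * a * (- k)              ≡⟨ expand b a k ⟩
      (b + a) - a - k * (+ 2 * a)      ≡⟨ cong (λ z → z - a - k * (+ 2 * a)) eq ⟩
      (r + k * (+ 2 * a)) - a - k * (+ 2 * a) ≡⟨ cancel r a k ⟩
      r - a                            ∎
      where
      open ≡-Reasoning
      expand : ∀ b a k → b + + 2 * a * (- k) ≡ (b + a) - a - k * (+ 2 * a)
      expand = solve-∀
      cancel : ∀ r a k → (r + k * (+ 2 * a)) - a - k * (+ 2 * a) ≡ r - a
      cancel = solve-∀
    b'≡r⊖a : b + + 2 * + a * (- k) ≡ r ⊖ a
    b'≡r⊖a = trans (shift b (+ a) (+ r) k (trans (a≡a%ℕn+[a/ℕn]*n (b + + a) (2 ℕ.* a)) (cong (λ z → + r + k * z) (ℤP.pos-* 2 a))))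
                   (ℤP.m-n≡m⊖n r a)

  Disc-19⇒ValuesOfQ : ℕ → Set
  Disc-19⇒ValuesOfQ a = 0 ℕ.< a → ∀ b c → discriminant (+ a) b c ≡ - + 19 → ValuesOfQ (+ a) b c

  discriminant-19⇒valuesOfQ : ∀ a → Disc-19⇒ValuesOfQ a
  discriminant-19⇒valuesOfQ = <-rec Disc-19⇒ValuesOfQ reduce
    where
    centred : ∀ a → (∀ {a'} → a' ℕ.< a → Disc-19⇒ValuesOfQ a') → 0 ℕ.< a →
      ∀ b c → ∣ b ∣ ℕ.≤ a → discriminant (+ a) b c ≡ - + 19 → ValuesOfQ (+ a) b c
    centred a ih 0<a b c ∣b∣≤a disc with discriminant-19⇒coefficients a b c 0<a disc
    ... | c' , refl , 4ac≡b²+19 with c' ℕ.<? a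
    ...   | yes c'<a = valuesOfQ-swap (+ a) b (+ c')
            (ih c'<a (*≡suc⇒0<ʳ (4 ℕ.* a) c' (trans 4ac≡b²+19 (ℕP.+-comm _ 19))) (- b) (+ a)
                (trans (discriminant-swap (+ a) b (+ c')) disc))
    ...   | no c'≮a with reduced-disc-19 a ∣ b ∣ c' 0<a ∣b∣≤a (ℕP.≮⇒≥ c'≮a) 4ac≡b²+19
    ...     | refl , ∣b∣≡1 , refl = valuesOfQ-principal b ∣b∣≡1
    reduce : ∀ a → (∀ {a'} → a' ℕ.< a → Disc-19⇒ValuesOfQ a') → Disc-19⇒ValuesOfQ a
    reduce a ih 0<a b c disc with centred-translate a b 0<a
    ... | q , ∣b'∣≤a = valuesOfQ-translate (+ a) b c q
          (centred a ih 0<a (b + + 2 * + a * q) (+ a * (q * q) + b * q + c) ∣b'∣≤a (trans (discriminant-translate (+ a) b c q) disc))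

  -- (d e, B, C) is Q under the unimodular substitution (w p ; t q); moving the factor e
  -- to the last coefficient keeps the discriminant and gives a form with first coefficient d.
  primitive-value-divisor⇒valueOfQ : ∀ w t p q → w * q - t * p ≡ + 1 →
    ∀ d e → 0 ℕ.< d → Q w t ≡ + d * e → ValueOfQ (+ d)
  primitive-value-divisor⇒valueOfQ w t p q det d e 0<d Q≡de =
    subst ValueOfQ (value-at-1,0 (+ d) B (e * C))
      (discriminant-19⇒valuesOfQ d 0<d B (e * C) disc (+ 1) (+ 0))
    where
    B C : ℤ
    B = w * (+ 2 * p) + w * q + t * p + + 10 * (t * q)
    C = Q p q
    regroup : ∀ B d e C → B * B - + 4 * d * (e * C) ≡ B * B - + 4 * (d * e) * C
    regroup = solve-∀
    substitution : ∀ w t p q →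
      (w * (+ 2 * p) + w * q + t * p + + 10 * (t * q)) * (w * (+ 2 * p) + w * q + t * p + + 10 * (t * q))
        - + 4 * (w * w + w * t + + 5 * (t * t)) * (p * p + p * q + + 5 * (q * q))
      ≡ - + 19 * ((w * q - t * p) * (w * q - t * p))
    substitution = solve-∀
    disc : discriminant (+ d) B (e * C) ≡ - + 19
    disc = begin
      B * B - + 4 * + d * (e * C)             ≡⟨ regroup B (+ d) e C ⟩
      B * B - + 4 * (+ d * e) * C             ≡⟨ cong (λ z → B * B - + 4 * z * C) Q≡de ⟨
      B * B - + 4 * Q w t * C                 ≡⟨ substitution w t p q ⟩
      - + 19 * ((w * q - t * p) * (w * q - t * p)) ≡⟨ cong (λ z → - + 19 * (z * z)) det ⟩
      - + 19                                  ∎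
      where open ≡-Reasoning
    value-at-1,0 : ∀ a b c → form a b c (+ 1) (+ 0) ≡ a
    value-at-1,0 a b c = expand a b c
      where
      expand : ∀ a b c → a * (+ 1 * + 1) + b * (+ 1 * + 0) + c * (+ 0 * + 0) ≡ a
      expand = solve-∀

  sgn : ℤ → ℤ
  sgn (+ _) = + 1
  sgn -[1+ _ ] = - + 1

  i*sgn[i]*n≡n*∣i∣ : ∀ i n → i * (sgn i * + n) ≡ + (n ℕ.* ∣ i ∣)
  i*sgn[i]*n≡n*∣i∣ (+ m) n = begin
    + m * (+ 1 * + n) ≡⟨ cong (+ m *_) (ℤP.*-identityˡ (+ n)) ⟩
    + m * + n         ≡⟨ ℤP.pos-* m n ⟨
    + (m ℕ.* n)       ≡⟨ cong +_ (ℕP.*-comm m n) ⟩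
    + (n ℕ.* m)       ∎
    where open ≡-Reasoning
  i*sgn[i]*n≡n*∣i∣ -[1+ m ] n = begin
    - + suc m * (- + 1 * + n) ≡⟨ negate (+ suc m) (+ n) ⟩
    + n * + suc m             ≡⟨ ℤP.pos-* n (suc m) ⟨
    + (n ℕ.* suc m)           ∎
    where
    open ≡-Reasoning
    negate : ∀ a n → - a * (- + 1 * n) ≡ n * a
    negate = solve-∀

  +[1+n]-+n≡1 : ∀ m n → 1 ℕ.+ n ≡ m → + m - + n ≡ + 1
  +[1+n]-+n≡1 _ n refl = trans (cong (_- + n) (ℤP.pos-+ 1 n)) (cancel (+ n))
    where
    cancel : ∀ n → (+ 1 + n) - n ≡ + 1
    cancel = solve-∀

  ℤ-Bézout : ∀ w t → Coprime ∣ w ∣ ∣ t ∣ → ∃[ p ] ∃[ q ] (w * q - t * p ≡ + 1)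
  ℤ-Bézout w t coprime with coprime-Bézout coprime
  ... | Bézout.+- X Y eq = sgn t * + Y , sgn w * + X ,
    trans (cong₂ _-_ (i*sgn[i]*n≡n*∣i∣ w X) (i*sgn[i]*n≡n*∣i∣ t Y)) (+[1+n]-+n≡1 _ _ eq)
  ... | Bézout.-+ X Y eq = - (sgn t * + Y) , - (sgn w * + X) ,
    trans (swap w t (sgn w * + X) (sgn t * + Y))
          (trans (cong₂ _-_ (i*sgn[i]*n≡n*∣i∣ t Y) (i*sgn[i]*n≡n*∣i∣ w X)) (+[1+n]-+n≡1 _ _ eq))
    where
    swap : ∀ w t u v → w * (- u) - t * (- v) ≡ t * v - w * u
    swap = solve-∀

  coprime-square-divisor : ∀ {d a R} → Coprime d R → d ℕ.* d ℕD.∣ a ℕ.* R → d ℕ.* d ℕD.∣ a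
  coprime-square-divisor {d} {a} {R} coprime d²∣aR =
    coprime-divisor (Coprimality.sym (coprime-* (Coprimality.sym coprime) (Coprimality.sym coprime)))
                    (subst (d ℕ.* d ℕD.∣_) (ℕP.*-comm a R) d²∣aR)

  square-divisor-of-coprime-product : ∀ {a R g} → Coprime a R → 1 ℕ.< g → g ℕ.* g ℕD.∣ a ℕ.* R →
    ∃[ d ] (1 ℕ.< d × d ℕD.∣ g × (d ℕ.* d ℕD.∣ a ⊎ d ℕ.* d ℕD.∣ R))
  square-divisor-of-coprime-product {a} {R} {g} coprime 1<g g²∣aR
    with gcd g a | gcd[m,n]∣m g a | gcd[m,n]∣n g a | (λ {d} → gcd-greatest {g} {a} {d})
  ... | 0 | 0∣g | _ | _ = contradiction (subst (1 ℕ.<_) (ℕD.0∣⇒≡0 0∣g) 1<g) λ ()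
  ... | 1 | _ | _ | greatest = g , 1<g , ℕD.∣-refl ,
    inj₂ (coprime-square-divisor (λ (d∣g , d∣a) → ℕD.∣1⇒≡1 (greatest d∣g d∣a)) (subst (g ℕ.* g ℕD.∣_) (ℕP.*-comm a R) g²∣aR))
  ... | h@(suc (suc _)) | h∣g | h∣a | _ = h , s≤s (s≤s z≤n) , h∣g ,
    inj₁ (coprime-square-divisor (λ (e∣h , e∣R) → coprime (ℕD.∣-trans e∣h h∣a , e∣R)) (ℕD.∣-trans (ℕD.*-pres-∣ h∣g h∣g) g²∣aR))

  Q-*-scale : ∀ d w t → Q (w * d) (t * d) ≡ d * d * Q w t
  Q-*-scale = expand
    where
    expand : ∀ d w t → (w * d) * (w * d) + (w * d) * (t * d) + + 5 * ((t * d) * (t * d)) ≡ d * d * (w * w + w * t + + 5 * (t * t))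
    expand = solve-∀

  valueOfQ-scale : ∀ d m → ValueOfQ (+ m) → ValueOfQ (+ (m ℕ.* (d ℕ.* d)))
  valueOfQ-scale d m (w , t , m≡Q) = w * + d , t * + d , (begin
    + (m ℕ.* (d ℕ.* d))  ≡⟨ ℤP.pos-* m (d ℕ.* d) ⟩
    + m * + (d ℕ.* d)    ≡⟨ cong₂ _*_ m≡Q (ℤP.pos-* d d) ⟩
    Q w t * (+ d * + d)  ≡⟨ ℤP.*-comm (Q w t) (+ d * + d) ⟩
    + d * + d * Q w t    ≡⟨ Q-*-scale (+ d) w t ⟨
    Q (w * + d) (t * + d) ∎)
    where open ≡-Reasoning

  common-divisor-descent : ∀ d n w t → 0 ℕ.< d → d ℕD.∣ ∣ w ∣ → d ℕD.∣ ∣ t ∣ → + n ≡ Q w t →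
    ∃[ m ] (n ≡ m ℕ.* (d ℕ.* d) × ValueOfQ (+ m))
  common-divisor-descent d@(suc _) n w t _ d∣w d∣t n≡Q
    with _∣_.quotient (∣ᵤ⇒∣ {+ d} {w} d∣w) | _∣_.equality (∣ᵤ⇒∣ {+ d} {w} d∣w)
       | _∣_.quotient (∣ᵤ⇒∣ {+ d} {t} d∣t) | _∣_.equality (∣ᵤ⇒∣ {+ d} {t} d∣t)
  ... | w₁ | refl | t₁ | refl = nonnegative (Q w₁ t₁) (trans n≡Q (Q-*-scale (+ d) w₁ t₁)) refl
    where
    nonnegative : ∀ q → + n ≡ + d * + d * q → q ≡ Q w₁ t₁ → ∃[ m ] (n ≡ m ℕ.* (d ℕ.* d) × ValueOfQ (+ m))
    nonnegative (+ m) eq q≡Q = m , ℤP.+-injective n≡m*d² , w₁ , t₁ , q≡Q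
      where
      n≡m*d² : + n ≡ + (m ℕ.* (d ℕ.* d))
      n≡m*d² = begin
        + n                  ≡⟨ eq ⟩
        + d * + d * + m      ≡⟨ cong (_* + m) (ℤP.pos-* d d) ⟨
        + (d ℕ.* d) * + m    ≡⟨ ℤP.*-comm (+ (d ℕ.* d)) (+ m) ⟩
        + m * + (d ℕ.* d)    ≡⟨ ℤP.pos-* m (d ℕ.* d) ⟨
        + (m ℕ.* (d ℕ.* d))  ∎
        where open ≡-Reasoning

  0<m*n⇒0<m : ∀ m n → 0 ℕ.< m ℕ.* n → 0 ℕ.< m
  0<m*n⇒0<m (suc _) _ _ = s≤s z≤n

  CoprimeFactorsAreValues : ℕ → Set
  CoprimeFactorsAreValues n = ∀ a R → a ℕ.* R ≡ n → 0 ℕ.< a → Coprime a R → ValueOfQ (+ n) → ValueOfQ (+ a)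

  descend-by-square : ∀ {n m d} → (∀ {m'} → m' ℕ.< n → CoprimeFactorsAreValues m') →
    1 ℕ.< d → 0 ℕ.< n → n ≡ m ℕ.* (d ℕ.* d) → ValueOfQ (+ m) →
    ∀ a R → a ℕ.* R ≡ n → 0 ℕ.< a → Coprime a R → d ℕ.* d ℕD.∣ a ⊎ d ℕ.* d ℕD.∣ R → ValueOfQ (+ a)
  descend-by-square {n} {m} {d} ih (s≤s (s≤s z≤n)) 0<n n≡md² value-m a R aR≡n 0<a coprime split = by-cases split
    where
    m<n : m ℕ.< n
    m<n = subst (m ℕ.<_) (sym n≡md²)
      (lemma m (0<m*n⇒0<m m (d ℕ.* d) (subst (0 ℕ.<_) n≡md² 0<n)))
      where
      lemma : ∀ m → 0 ℕ.< m → m ℕ.< m ℕ.* (d ℕ.* d)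
      lemma m@(suc _) _ = ℕP.m<m*n m (d ℕ.* d) (s≤s (s≤s z≤n))
    cancel : ∀ x y → x ℕ.* y ℕ.* (d ℕ.* d) ≡ m ℕ.* (d ℕ.* d) → x ℕ.* y ≡ m
    cancel x y = ℕP.*-cancelʳ-≡ (x ℕ.* y) m (d ℕ.* d)
    by-cases : d ℕ.* d ℕD.∣ a ⊎ d ℕ.* d ℕD.∣ R → ValueOfQ (+ a)
    by-cases (inj₁ (divides a₂ refl)) =
      valueOfQ-scale d a₂ (ih m<n a₂ R (cancel a₂ R (trans (xy∙z≈xz∙y a₂ R (d ℕ.* d)) (trans aR≡n n≡md²)))
        (0<m*n⇒0<m a₂ (d ℕ.* d) 0<a) (λ (e∣a₂ , e∣R) → coprime (ℕD.∣-trans e∣a₂ (ℕD.m∣m*n (d ℕ.* d)) , e∣R)) value-m)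
    by-cases (inj₂ (divides R₂ refl)) =
      ih m<n a R₂ (cancel a R₂ (trans (ℕP.*-assoc a R₂ (d ℕ.* d)) (trans aR≡n n≡md²))) 0<a
        (λ (e∣a , e∣R₂) → coprime (e∣a , ℕD.∣-trans e∣R₂ (ℕD.m∣m*n (d ℕ.* d)))) value-m

  -- Descent on n = Q w t: a common factor d of w and t has d² dividing a or R (the one it shares a
  -- factor with), and is divided out of both; once w and t are coprime, Bézout applies.
  coprime-factors-are-values : ∀ n → CoprimeFactorsAreValues n
  coprime-factors-are-values = <-rec CoprimeFactorsAreValues descend
    where
    descend : ∀ n → (∀ {m} → m ℕ.< n → CoprimeFactorsAreValues m) → CoprimeFactorsAreValues n
    descend n ih a 0 _ _ coprime _ =
      subst (λ a → ValueOfQ (+ a)) (sym (coprime (ℕD.∣-refl , a ℕD.∣0))) (+ 1 , + 0 , refl)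
    descend n ih a R@(suc _) aR≡n 0<a coprime (w , t , n≡Q)
      with gcd ∣ w ∣ ∣ t ∣ | gcd[m,n]∣m ∣ w ∣ ∣ t ∣ | gcd[m,n]∣n ∣ w ∣ ∣ t ∣ | (λ {d} → gcd-greatest {∣ w ∣} {∣ t ∣} {d})
    ... | 0 | 0∣w | 0∣t | _ = contradiction n≡0 (ℕP.>⇒≢ 0<n)
      where
      0<n : 0 ℕ.< n
      0<n = subst (0 ℕ.<_) aR≡n (ℕP.*-mono-< 0<a (s≤s z≤n))
      n≡0 : n ≡ 0
      n≡0 = ℤP.+-injective (trans n≡Q (cong₂ Q (ℤP.∣i∣≡0⇒i≡0 {w} (ℕD.0∣⇒≡0 0∣w)) (ℤP.∣i∣≡0⇒i≡0 {t} (ℕD.0∣⇒≡0 0∣t))))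
    ... | 1 | _ | _ | greatest with ℤ-Bézout w t (λ (d∣w , d∣t) → ℕD.∣1⇒≡1 (greatest d∣w d∣t))
    ...   | p , q , det = primitive-value-divisor⇒valueOfQ w t p q det a (+ R) 0<a
            (trans (sym n≡Q) (trans (cong +_ (sym aR≡n)) (ℤP.pos-* a R)))
    descend n ih a R@(suc _) aR≡n 0<a coprime (w , t , n≡Q)
        | g@(suc (suc _)) | g∣w | g∣t | _
      with common-divisor-descent g n w t (s≤s z≤n) g∣w g∣t n≡Q
    ... | m , n≡mg² , _ with square-divisor-of-coprime-product coprime (s≤s (s≤s z≤n)) (divides m (trans aR≡n n≡mg²))
    ...   | d , 1<d , d∣g , split with common-divisor-descent d n w t (ℕP.<-trans (s≤s z≤n) 1<d) (ℕD.∣-trans d∣g g∣w) (ℕD.∣-trans d∣g g∣t) n≡Q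
    ...     | m' , n≡m'd² , value-m' = descend-by-square ih 1<d 0<n n≡m'd² value-m' a R aR≡n 0<a coprime split
      where
      0<n : 0 ℕ.< n
      0<n = subst (0 ℕ.<_) aR≡n (ℕP.*-mono-< 0<a (s≤s z≤n))

  coprime-factors-of-value : ∀ {a b R} → 0 ℕ.< a → 0 ℕ.< b → Coprime a (b ℕ.* R) → Coprime b (a ℕ.* R) →
    ValueOfQ (+ (a ℕ.* (b ℕ.* R))) → ValueOfQ (+ a) × ValueOfQ (+ b)
  coprime-factors-of-value {a} {b} {R} 0<a 0<b coprime-a coprime-b value =
      coprime-factors-are-values _ a (b ℕ.* R) refl 0<a coprime-a value
    , coprime-factors-are-values _ b (a ℕ.* R) refl 0<b coprime-b
        (subst (λ m → ValueOfQ (+ m)) (x∙yz≈y∙xz a b R) value)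

module PellEquation where

  open import Data.Nat
  open import Data.Nat.Properties
  open import Data.Nat.Divisibility using (_∣_; ∣-trans; ∣1⇒≡1; ∣m+n∣m⇒∣n; ∣m⇒∣m*n; ∣n⇒∣m*n; m∣m*n; n∣m*n)
  open import Data.Nat.Coprimality using (coprime?)
  open import Data.Nat.Tactic.RingSolver using (solve-∀)
  open import Data.Fin using (Fin; toℕ; fromℕ<)
  open import Data.Fin.Properties using (all?; toℕ-fromℕ<)
  open import Relation.Nullary using (¬?)
  open import Relation.Nullary.Decidable using (from-yes)
  open import Relation.Binary.Definitions using (tri<; tri≈; tri>)

  StrictlyIncreasing : (ℕ → ℕ) → Set
  StrictlyIncreasing f = ∀ k → f k < f (suc k)

  strictlyIncreasing⇒<-mono : ∀ {f} → StrictlyIncreasing f → ∀ {i j} → i < j → f i < f j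
  strictlyIncreasing⇒<-mono f↑ {i} {suc j} (s≤s i≤j) with m≤n⇒m<n∨m≡n i≤j
  ... | inj₁ i<j = <-trans (strictlyIncreasing⇒<-mono f↑ i<j) (f↑ j)
  ... | inj₂ refl = f↑ j

  strictlyIncreasing⇒<-reflecting : ∀ {f} → StrictlyIncreasing f → ∀ {i j} → f i < f j → i < j
  strictlyIncreasing⇒<-reflecting {f} f↑ {i} {j} fi<fj with i <? j
  ... | yes i<j = i<j
  ... | no i≮j with m≤n⇒m<n∨m≡n (≮⇒≥ i≮j)
  ...   | inj₁ j<i = contradiction (strictlyIncreasing⇒<-mono f↑ j<i) (<⇒≯ fi<fj)
  ...   | inj₂ refl = contradiction fi<fj (<-irrefl refl)

  strictlyIncreasing-same-range⇒≗ : ∀ {f g} → StrictlyIncreasing f → StrictlyIncreasing g →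
    (∀ i → ∃[ j ] f i ≡ g j) → (∀ j → ∃[ i ] g j ≡ f i) → ∀ k → f k ≡ g k
  strictlyIncreasing-same-range⇒≗ {f} {g} f↑ g↑ f⊆g g⊆f = <-rec (λ k → f k ≡ g k) step
    where
    step : ∀ k → (∀ {i} → i < k → f i ≡ g i) → f k ≡ g k
    step k ih with f⊆g k | g⊆f k
    ... | j , fk≡gj | i , gk≡fi with <-cmp i k
    ...   | tri≈ _ refl _ = sym gk≡fi
    ...   | tri< i<k _ _ = contradiction (trans gk≡fi (ih i<k)) (>⇒≢ (strictlyIncreasing⇒<-mono g↑ i<k))
    ...   | tri> _ _ k<i = contradiction (trans (ih j<k) (sym fk≡gj)) (<⇒≢ (strictlyIncreasing⇒<-mono f↑ j<k))
      where
      j<k : j < k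
      j<k = strictlyIncreasing⇒<-reflecting g↑ (subst₂ _<_ fk≡gj (sym gk≡fi) (strictlyIncreasing⇒<-mono f↑ k<i))

  m*m≤n*n⇒m≤n : ∀ m n → m * m ≤ n * n → m ≤ n
  m*m≤n*n⇒m≤n m n m²≤n² with m ≤? n
  ... | yes m≤n = m≤n
  ... | no m≰n = contradiction m²≤n² (<⇒≱ (*-mono-< (≰⇒> m≰n) (≰⇒> m≰n)))

  m*m<n*n⇒m<n : ∀ m n → m * m < n * n → m < n
  m*m<n*n⇒m<n m n m²<n² with m <? n
  ... | yes m<n = m<n
  ... | no m≮n = contradiction (*-mono-≤ (≮⇒≥ m≮n) (≮⇒≥ m≮n)) (<⇒≱ m²<n²)

  -- x k + y k √19 = (170 + 39 √19) ^ k.  Opaque: unfolding the numeral coefficients in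
  -- conversion checking is prohibitively expensive.
  opaque
    x y : ℕ → ℕ
    x zero = 1
    x (suc k) = 170 * x k + 741 * y k
    y zero = 0
    y (suc k) = 39 * x k + 170 * y k

  opaque
    unfolding x
    x-zero : x 0 ≡ 1
    x-zero = refl
    y-zero : y 0 ≡ 0
    y-zero = refl
    x-suc : ∀ k → x (suc k) ≡ 170 * x k + 741 * y k
    x-suc _ = refl
    y-suc : ∀ k → y (suc k) ≡ 39 * x k + 170 * y k
    y-suc _ = refl

  -- The norm is multiplicative, arranged so that no subtraction occurs.
  norm-step : ∀ a b → (170 * a + 741 * b) * (170 * a + 741 * b) + 19 * (b * b)
                      ≡ a * a + 19 * ((39 * a + 170 * b) * (39 * a + 170 * b))
  norm-step = solve-∀

  pellSol-step : ∀ {a b} → PellSol a b → PellSol (170 * a + 741 * b) (39 * a + 170 * b)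
  pellSol-step {a} {b} sol = +-cancelʳ-≡ (19 * (b * b)) (a' * a') (1 + 19 * (b' * b')) (begin
    a' * a' + 19 * (b * b)                 ≡⟨ norm-step a b ⟩
    a * a + 19 * (b' * b')                 ≡⟨ cong (_+ 19 * (b' * b')) sol ⟩
    1 + 19 * (b * b) + 19 * (b' * b')      ≡⟨ cong suc (+-comm (19 * (b * b)) _) ⟩
    1 + 19 * (b' * b') + 19 * (b * b)      ∎)
    where
    open ≡-Reasoning
    a' b' : ℕ
    a' = 170 * a + 741 * b
    b' = 39 * a + 170 * b

  pellSol-step⁻¹ : ∀ {a b} → PellSol (170 * a + 741 * b) (39 * a + 170 * b) → PellSol a b
  pellSol-step⁻¹ {a} {b} sol = +-cancelʳ-≡ (19 * (b' * b')) (a * a) (1 + 19 * (b * b)) (begin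
    a * a + 19 * (b' * b')                 ≡⟨ norm-step a b ⟨
    a' * a' + 19 * (b * b)                 ≡⟨ cong (_+ 19 * (b * b)) sol ⟩
    1 + 19 * (b' * b') + 19 * (b * b)      ≡⟨ cong suc (+-comm (19 * (b' * b')) _) ⟩
    1 + 19 * (b * b) + 19 * (b' * b')      ∎)
    where
    open ≡-Reasoning
    a' b' : ℕ
    a' = 170 * a + 741 * b
    b' = 39 * a + 170 * b

  pellSol-x-y : ∀ k → PellSol (x k) (y k)
  pellSol-x-y zero = subst₂ PellSol (sym x-zero) (sym y-zero) refl
  pellSol-x-y (suc k) = subst₂ PellSol (sym (x-suc k)) (sym (y-suc k)) (pellSol-step {x k} {y k} (pellSol-x-y k))

  x-positive : ∀ k → 0 < x k
  x-positive zero rewrite x-zero = s≤s z≤n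
  x-positive (suc k) rewrite x-suc k = <-≤-trans (x-positive k) (≤-trans (m≤n*m (x k) 170) (m≤m+n _ _))

  y-increasing : ∀ k → y k < y (suc k)
  y-increasing k rewrite y-suc k = <-≤-trans (m<n+m (y k) (x-positive k)) (+-mono-≤ (m≤n*m (x k) 39) (m≤n*m (y k) 170))

  NotPellSol : Fin 38 → Fin 171 → Set
  NotPellSol b a = ¬ PellSol (toℕ a) (suc (toℕ b))

  no-small-pellSol : ∀ b a → NotPellSol b a
  no-small-pellSol = from-yes (all? {P = λ b → ∀ a → NotPellSol b a} λ b →
                               all? {P = NotPellSol b} λ a → ¬? (_ ≟ _))

  pellSol⇒39≤y : ∀ {a b} → PellSol a b → 0 < b → 39 ≤ b
  pellSol⇒39≤y {a} {suc b} sol _ with suc b <? 39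
  ... | no b≮39 = ≮⇒≥ b≮39
  ... | yes (s≤s b<38) = ⊥-elim (no-small-pellSol (fromℕ< b<38) (fromℕ< a<171)
                            (subst₂ PellSol (sym (toℕ-fromℕ< a<171)) (cong suc (sym (toℕ-fromℕ< b<38))) sol))
    where
    a<171 : a < 171
    a<171 = m*m<n*n⇒m<n a 171 (begin-strict
      a * a                          ≡⟨ sol ⟩
      1 + 19 * (suc b * suc b)       ≤⟨ +-monoʳ-≤ 1 (*-monoʳ-≤ 19 (*-mono-≤ b<38 b<38)) ⟩
      1 + 19 * (38 * 38)             <⟨ from-yes (27437 <? 29241) ⟩
      171 * 171                      ∎)
      where open ≤-Reasoning

  -- Only 39 a ≤ 170 b needs b ≥ 39.
  pellSol-inequalities : ∀ {a b} → PellSol a b → 39 ≤ b →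
    741 * b ≤ 170 * a × 39 * a ≤ 170 * b × 169 * b < 39 * a
  pellSol-inequalities {a} {b} sol 39≤b =
      m*m≤n*n⇒m≤n _ _ (begin
        741 * b * (741 * b)          ≡⟨ square 741 b ⟩
        549081 * (b * b)              ≤⟨ *-monoˡ-≤ (b * b) (from-yes (549081 ≤? 549100)) ⟩
        549100 * (b * b)              ≤⟨ m≤n+m _ 28900 ⟩
        28900 + 549100 * (b * b)      ≡⟨ distribute 28900 (b * b) ⟨
        28900 * (1 + 19 * (b * b))    ≡⟨ cong (28900 *_) sol ⟨
        28900 * (a * a)               ≡⟨ square 170 a ⟨
        170 * a * (170 * a)           ∎)
    , m*m≤n*n⇒m≤n _ _ (begin
        39 * a * (39 * a)             ≡⟨ square 39 a ⟩
        1521 * (a * a)                ≡⟨ cong (1521 *_) sol ⟩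
        1521 * (1 + 19 * (b * b))     ≡⟨ distribute 1521 (b * b) ⟩
        1521 + 28899 * (b * b)        ≤⟨ +-monoˡ-≤ _ (*-mono-≤ 39≤b 39≤b) ⟩
        28900 * (b * b)               ≡⟨ square 170 b ⟨
        170 * b * (170 * b)           ∎)
    , m*m<n*n⇒m<n _ _ (begin-strict
        169 * b * (169 * b)           ≡⟨ square 169 b ⟩
        28561 * (b * b)               ≤⟨ *-monoˡ-≤ (b * b) (from-yes (28561 ≤? 28899)) ⟩
        28899 * (b * b)               <⟨ m<n+m _ {1521} (s≤s z≤n) ⟩
        1521 + 28899 * (b * b)        ≡⟨ distribute 1521 (b * b) ⟨
        1521 * (1 + 19 * (b * b))     ≡⟨ cong (1521 *_) sol ⟨
        1521 * (a * a)                ≡⟨ square 39 a ⟨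
        39 * a * (39 * a)             ∎)
    where
    open ≤-Reasoning
    square : ∀ c b → c * b * (c * b) ≡ c * c * (b * b)
    square = solve-∀
    distribute : ∀ c u → c * (1 + 19 * u) ≡ c + (c * 19) * u
    distribute = solve-∀

  -- Multiplication by 170 - 39 √19; the matrix (170 741 ; 39 170) has determinant 1.
  pellSol-predecessor : ∀ {a b} → PellSol a b → 39 ≤ b →
    ∃[ a' ] ∃[ b' ] (a ≡ 170 * a' + 741 * b' × b ≡ 39 * a' + 170 * b' × b' < b)
  pellSol-predecessor {a} {b} sol 39≤b =
    let 741b≤170a , 39a≤170b , 169b<39a = pellSol-inequalities {a} {b} sol 39≤b
    in predecessor 169b<39a (m≤n⇒∃[o]m+o≡n 741b≤170a) (m≤n⇒∃[o]m+o≡n 39a≤170b)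
    where
    predecessor : 169 * b < 39 * a → ∃[ a' ] 741 * b + a' ≡ 170 * a → ∃[ b' ] 39 * a + b' ≡ 170 * b →
      ∃[ a' ] ∃[ b' ] (a ≡ 170 * a' + 741 * b' × b ≡ 39 * a' + 170 * b' × b' < b)
    predecessor 169b<39a (a' , eq₁) (b' , eq₂) = a' , b' , a≡ , b≡ , b'<b
      where
      open ≤-Reasoning
      a≡ : a ≡ 170 * a' + 741 * b'
      a≡ = +-cancelʳ-≡ (28899 * a + 125970 * b) a (170 * a' + 741 * b') (begin-equality
        a + (28899 * a + 125970 * b)                 ≡⟨ expand₁ a b ⟩
        170 * (170 * a) + 741 * (170 * b)            ≡⟨ cong₂ (λ u v → 170 * u + 741 * v) eq₁ eq₂ ⟨
        170 * (741 * b + a') + 741 * (39 * a + b')   ≡⟨ expand₂ a b a' b' ⟩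
        170 * a' + 741 * b' + (28899 * a + 125970 * b) ∎)
        where
        expand₁ : ∀ a b → a + (28899 * a + 125970 * b) ≡ 170 * (170 * a) + 741 * (170 * b)
        expand₁ = solve-∀
        expand₂ : ∀ a b a' b' → 170 * (741 * b + a') + 741 * (39 * a + b') ≡ 170 * a' + 741 * b' + (28899 * a + 125970 * b)
        expand₂ = solve-∀
      b≡ : b ≡ 39 * a' + 170 * b'
      b≡ = +-cancelʳ-≡ (28899 * b + 6630 * a) b (39 * a' + 170 * b') (begin-equality
        b + (28899 * b + 6630 * a)                   ≡⟨ expand₁ a b ⟩
        39 * (170 * a) + 170 * (170 * b)             ≡⟨ cong₂ (λ u v → 39 * u + 170 * v) eq₁ eq₂ ⟨
        39 * (741 * b + a') + 170 * (39 * a + b')    ≡⟨ expand₂ a b a' b' ⟩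
        39 * a' + 170 * b' + (28899 * b + 6630 * a)  ∎)
        where
        expand₁ : ∀ a b → b + (28899 * b + 6630 * a) ≡ 39 * (170 * a) + 170 * (170 * b)
        expand₁ = solve-∀
        expand₂ : ∀ a b a' b' → 39 * (741 * b + a') + 170 * (39 * a + b') ≡ 39 * a' + 170 * b' + (28899 * b + 6630 * a)
        expand₂ = solve-∀
      b'<b : b' < b
      b'<b = +-cancelˡ-< (39 * a) b' b (begin-strict
        39 * a + b'  ≡⟨ eq₂ ⟩
        170 * b      ≡⟨ +-comm b (169 * b) ⟩
        169 * b + b  <⟨ +-monoˡ-< b 169b<39a ⟩
        39 * a + b   ∎)

  InPellSequence : ℕ → Set
  InPellSequence b = ∀ a → PellSol a b → ∃[ k ] (a ≡ x k × b ≡ y k)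

  pellSol⇒inPellSequence : ∀ b → InPellSequence b
  pellSol⇒inPellSequence = <-rec InPellSequence descend
    where
    descend : ∀ b → (∀ {b'} → b' < b → InPellSequence b') → InPellSequence b
    descend zero _ a sol = 0 , trans (m*n≡1⇒m≡1 a a sol) (sym x-zero) , sym y-zero
    descend b@(suc _) ih a sol = lift (pellSol-predecessor {a} {b} sol (pellSol⇒39≤y {a} {b} sol (s≤s z≤n)))
      where
      lift : ∃[ a' ] ∃[ b' ] (a ≡ 170 * a' + 741 * b' × b ≡ 39 * a' + 170 * b' × b' < b) → ∃[ k ] (a ≡ x k × b ≡ y k)
      lift (a' , b' , a≡ , b≡ , b'<b) = step (ih b'<b a' (pellSol-step⁻¹ {a'} {b'} (subst₂ PellSol a≡ b≡ sol)))
        where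
        step : ∃[ k ] (a' ≡ x k × b' ≡ y k) → ∃[ k ] (a ≡ x k × b ≡ y k)
        step (k , a'≡xk , b'≡yk) = suc k , trans a≡ (trans (cong₂ (λ u v → 170 * u + 741 * v) a'≡xk b'≡yk) (sym (x-suc k)))
                                         , trans b≡ (trans (cong₂ (λ u v → 39 * u + 170 * v) a'≡xk b'≡yk) (sym (y-suc k)))

  x-y-+ : ∀ m n → x (m + n) ≡ x m * x n + 19 * (y m * y n) × y (m + n) ≡ x m * y n + y m * x n
  x-y-+ zero n rewrite x-zero | y-zero = sym (trans (+-identityʳ (x n + 0)) (+-identityʳ (x n))) , sym (trans (+-identityʳ (y n + 0)) (+-identityʳ (y n)))
  x-y-+ (suc m) n rewrite x-suc (m + n) | y-suc (m + n) | x-suc m | y-suc m with x-y-+ m n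
  ... | hx , hy = trans (cong₂ (λ u v → 170 * u + 741 * v) hx hy) (expandₓ (x m) (y m) (x n) (y n)) ,
                  trans (cong₂ (λ u v → 39 * u + 170 * v) hx hy) (expandᵧ (x m) (y m) (x n) (y n))
    where
    expandₓ : ∀ a b c d → 170 * (a * c + 19 * (b * d)) + 741 * (a * d + b * c)
                         ≡ (170 * a + 741 * b) * c + 19 * ((39 * a + 170 * b) * d)
    expandₓ = solve-∀
    expandᵧ : ∀ a b c d → 39 * (a * c + 19 * (b * d)) + 170 * (a * d + b * c)
                         ≡ (170 * a + 741 * b) * d + (39 * a + 170 * b) * c
    expandᵧ = solve-∀

  y-double : ∀ j → y (j + j) ≡ y j * (2 * x j)
  y-double j = trans (proj₂ (x-y-+ j j)) (regroup (x j) (y j))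
    where
    regroup : ∀ a b → a * b + b * a ≡ b * (2 * a)
    regroup = solve-∀

  coprime-x-y : ∀ k → Coprime (x k) (y k)
  coprime-x-y k {d} (d∣x , d∣y) = ∣1⇒≡1 (∣m+n∣m⇒∣n d∣19y²+1 (∣n⇒∣m*n 19 (∣m⇒∣m*n (y k) d∣y)))
    where
    d∣19y²+1 : d ∣ 19 * (y k * y k) + 1
    d∣19y²+1 = subst (d ∣_) (trans (pellSol-x-y k) (+-comm 1 _)) (∣m⇒∣m*n (x k) d∣x)

  y[2^e*m]≡y[m]*R : ∀ e m → Coprime (y m) 2 → ∃[ R ] (y (2 ^ e * m) ≡ y m * R × Coprime (y m) R)
  y[2^e*m]≡y[m]*R zero m _ = 1 , trans (cong y (+-identityʳ m)) (sym (*-identityʳ (y m))) , λ (_ , d∣1) → ∣1⇒≡1 d∣1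
  y[2^e*m]≡y[m]*R (suc e) m coprime-2 with y[2^e*m]≡y[m]*R e m coprime-2
  ... | R , yj≡ymR , coprime-R = R * (2 * x j) , y2j≡ymR' , coprime-* coprime-R (coprime-* coprime-2 coprime-x)
    where
    j : ℕ
    j = 2 ^ e * m
    open ≡-Reasoning
    y2j≡ymR' : y (2 ^ suc e * m) ≡ y m * (R * (2 * x j))
    y2j≡ymR' = begin
      y (2 * 2 ^ e * m)     ≡⟨ cong y (*-assoc 2 (2 ^ e) m) ⟩
      y (2 * j)             ≡⟨ cong (λ i → y (j + i)) (+-identityʳ j) ⟩
      y (j + j)             ≡⟨ y-double j ⟩
      y j * (2 * x j)       ≡⟨ cong (_* (2 * x j)) yj≡ymR ⟩
      y m * R * (2 * x j)   ≡⟨ *-assoc (y m) R (2 * x j) ⟩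
      y m * (R * (2 * x j)) ∎
    coprime-x : Coprime (y m) (x j)
    coprime-x (d∣ym , d∣xj) = coprime-x-y j (d∣xj , ∣-trans d∣ym (subst (y m ∣_) (sym yj≡ymR) (m∣m*n R)))

  -- 13 B k + 3 A k √19 = (13 + 3 √19) (170 + 39 √19) ^ k,  and  (13 + 3 √19)² = 2 (170 + 39 √19).
  opaque
    A B : ℕ → ℕ
    A zero = 1
    A (suc k) = 170 * A k + 169 * B k
    B zero = 1
    B (suc k) = 171 * A k + 170 * B k

  opaque
    unfolding A
    A-zero : A 0 ≡ 1
    A-zero = refl
    B-zero : B 0 ≡ 1
    B-zero = refl
    A-suc : ∀ k → A (suc k) ≡ 170 * A k + 169 * B k
    A-suc _ = refl
    B-suc : ∀ k → B (suc k) ≡ 171 * A k + 170 * B k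
    B-suc _ = refl

  3A≡3x+13y×13B≡13x+57y : ∀ k → 3 * A k ≡ 3 * x k + 13 * y k × 13 * B k ≡ 13 * x k + 57 * y k
  3A≡3x+13y×13B≡13x+57y zero =
      trans (cong (3 *_) A-zero) (sym (cong₂ (λ u v → 3 * u + 13 * v) x-zero y-zero))
    , trans (cong (13 *_) B-zero) (sym (cong₂ (λ u v → 13 * u + 57 * v) x-zero y-zero))
  3A≡3x+13y×13B≡13x+57y (suc k) =
      (begin
        3 * A (suc k)                                            ≡⟨ cong (3 *_) (A-suc k) ⟩
        3 * (170 * A k + 169 * B k)                              ≡⟨ regroupᴬ (A k) (B k) ⟩
        170 * (3 * A k) + 39 * (13 * B k)                        ≡⟨ cong₂ (λ u v → 170 * u + 39 * v) 3A≡ 13B≡ ⟩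
        170 * (3 * x k + 13 * y k) + 39 * (13 * x k + 57 * y k)  ≡⟨ expandᴬ (x k) (y k) ⟩
        3 * (170 * x k + 741 * y k) + 13 * (39 * x k + 170 * y k) ≡⟨ cong₂ (λ u v → 3 * u + 13 * v) (x-suc k) (y-suc k) ⟨
        3 * x (suc k) + 13 * y (suc k)                           ∎)
    , (begin
        13 * B (suc k)                                           ≡⟨ cong (13 *_) (B-suc k) ⟩
        13 * (171 * A k + 170 * B k)                             ≡⟨ regroupᴮ (A k) (B k) ⟩
        741 * (3 * A k) + 170 * (13 * B k)                       ≡⟨ cong₂ (λ u v → 741 * u + 170 * v) 3A≡ 13B≡ ⟩
        741 * (3 * x k + 13 * y k) + 170 * (13 * x k + 57 * y k) ≡⟨ expandᴮ (x k) (y k) ⟩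
        13 * (170 * x k + 741 * y k) + 57 * (39 * x k + 170 * y k) ≡⟨ cong₂ (λ u v → 13 * u + 57 * v) (x-suc k) (y-suc k) ⟨
        13 * x (suc k) + 57 * y (suc k)                          ∎)
    where
    open ≡-Reasoning
    3A≡ : 3 * A k ≡ 3 * x k + 13 * y k
    3A≡ = proj₁ (3A≡3x+13y×13B≡13x+57y k)
    13B≡ : 13 * B k ≡ 13 * x k + 57 * y k
    13B≡ = proj₂ (3A≡3x+13y×13B≡13x+57y k)
    regroupᴬ : ∀ a b → 3 * (170 * a + 169 * b) ≡ 170 * (3 * a) + 39 * (13 * b)
    regroupᴬ = solve-∀
    regroupᴮ : ∀ a b → 13 * (171 * a + 170 * b) ≡ 741 * (3 * a) + 170 * (13 * b)
    regroupᴮ = solve-∀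
    expandᴬ : ∀ u v → 170 * (3 * u + 13 * v) + 39 * (13 * u + 57 * v) ≡ 3 * (170 * u + 741 * v) + 13 * (39 * u + 170 * v)
    expandᴬ = solve-∀
    expandᴮ : ∀ u v → 741 * (3 * u + 13 * v) + 170 * (13 * u + 57 * v) ≡ 13 * (170 * u + 741 * v) + 57 * (39 * u + 170 * v)
    expandᴮ = solve-∀

  y-odd : ∀ k → y (k + suc k) ≡ 39 * (A k * B k)
  y-odd k = begin
    y (k + suc k)                                                   ≡⟨ proj₂ (x-y-+ k (suc k)) ⟩
    x k * y (suc k) + y k * x (suc k)                               ≡⟨ cong₂ (λ u v → x k * u + y k * v) (y-suc k) (x-suc k) ⟩
    x k * (39 * x k + 170 * y k) + y k * (170 * x k + 741 * y k)    ≡⟨ factor (x k) (y k) ⟩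
    (3 * x k + 13 * y k) * (13 * x k + 57 * y k)                    ≡⟨ cong₂ _*_ (proj₁ A-B≡) (proj₂ A-B≡) ⟨
    3 * A k * (13 * B k)                                            ≡⟨ regroup (A k) (B k) ⟩
    39 * (A k * B k)                                                ∎
    where
    open ≡-Reasoning
    A-B≡ : 3 * A k ≡ 3 * x k + 13 * y k × 13 * B k ≡ 13 * x k + 57 * y k
    A-B≡ = 3A≡3x+13y×13B≡13x+57y k
    factor : ∀ u v → u * (39 * u + 170 * v) + v * (170 * u + 741 * v) ≡ (3 * u + 13 * v) * (13 * u + 57 * v)
    factor = solve-∀
    regroup : ∀ a b → 3 * a * (13 * b) ≡ 39 * (a * b)
    regroup = solve-∀

  A-B-norm : ∀ k → 171 * (A k * A k) ≡ 2 + 169 * (B k * B k)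
  A-B-norm k = +-cancelʳ-≡ (38 * (y k * y k)) (171 * (A k * A k)) (2 + 169 * (B k * B k)) (begin
    171 * (A k * A k) + 38 * (y k * y k)                            ≡⟨ square (A k) (y k) ⟩
    19 * (3 * A k * (3 * A k)) + 38 * (y k * y k)                   ≡⟨ cong (λ u → 19 * (u * u) + 38 * (y k * y k)) (proj₁ A-B≡) ⟩
    19 * ((3 * x k + 13 * y k) * (3 * x k + 13 * y k)) + 38 * (y k * y k) ≡⟨ norm (x k) (y k) ⟩
    (13 * x k + 57 * y k) * (13 * x k + 57 * y k) + 2 * (x k * x k) ≡⟨ cong₂ (λ u v → u * u + 2 * v) (sym (proj₂ A-B≡)) (pellSol-x-y k) ⟩
    13 * B k * (13 * B k) + 2 * (1 + 19 * (y k * y k))              ≡⟨ regroup (B k) (y k) ⟩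
    2 + 169 * (B k * B k) + 38 * (y k * y k)                        ∎)
    where
    open ≡-Reasoning
    A-B≡ : 3 * A k ≡ 3 * x k + 13 * y k × 13 * B k ≡ 13 * x k + 57 * y k
    A-B≡ = 3A≡3x+13y×13B≡13x+57y k
    square : ∀ a v → 171 * (a * a) + 38 * (v * v) ≡ 19 * (3 * a * (3 * a)) + 38 * (v * v)
    square = solve-∀
    norm : ∀ u v → 19 * ((3 * u + 13 * v) * (3 * u + 13 * v)) + 38 * (v * v) ≡ (13 * u + 57 * v) * (13 * u + 57 * v) + 2 * (u * u)
    norm = solve-∀
    regroup : ∀ b v → 13 * b * (13 * b) + 2 * (1 + 19 * (v * v)) ≡ 2 + 169 * (b * b) + 38 * (v * v)
    regroup = solve-∀

  Odd : ℕ → Set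
  Odd n = ∃[ h ] n ≡ 1 + 2 * h

  odd⇒0< : ∀ {n} → Odd n → 0 < n
  odd⇒0< (_ , refl) = s≤s z≤n

  odd⇒coprime-2 : ∀ {n} → Odd n → Coprime 2 n
  odd⇒coprime-2 (h , refl) {d} (d∣2 , d∣1+2h) =
    ∣1⇒≡1 (∣m+n∣m⇒∣n (subst (d ∣_) (+-comm 1 (2 * h)) d∣1+2h) (∣m⇒∣m*n h d∣2))

  odd-A×odd-B : ∀ k → Odd (A k) × Odd (B k)
  odd-A×odd-B zero = (0 , A-zero) , (0 , B-zero)
  odd-A×odd-B (suc k) =
      (169 + 170 * h + 169 * h' , trans (A-suc k) (trans (cong₂ (λ u v → 170 * u + 169 * v) A≡ B≡) (expandᴬ h h')))
    , (170 + 171 * h + 170 * h' , trans (B-suc k) (trans (cong₂ (λ u v → 171 * u + 170 * v) A≡ B≡) (expandᴮ h h')))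
    where
    h h' : ℕ
    h = proj₁ (proj₁ (odd-A×odd-B k))
    h' = proj₁ (proj₂ (odd-A×odd-B k))
    A≡ : A k ≡ 1 + 2 * h
    A≡ = proj₂ (proj₁ (odd-A×odd-B k))
    B≡ : B k ≡ 1 + 2 * h'
    B≡ = proj₂ (proj₂ (odd-A×odd-B k))
    expandᴬ : ∀ h h' → 170 * (1 + 2 * h) + 169 * (1 + 2 * h') ≡ 1 + 2 * (169 + 170 * h + 169 * h')
    expandᴬ = solve-∀
    expandᴮ : ∀ h h' → 171 * (1 + 2 * h) + 170 * (1 + 2 * h') ≡ 1 + 2 * (170 + 171 * h + 170 * h')
    expandᴮ = solve-∀

  coprime-A-B : ∀ k → Coprime (A k) (B k)
  coprime-A-B k {d} (d∣A , d∣B) = odd⇒coprime-2 (proj₁ (odd-A×odd-B k)) (d∣2 , d∣A)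
    where
    d∣2 : d ∣ 2
    d∣2 = ∣m+n∣m⇒∣n (subst (d ∣_) (trans (A-B-norm k) (+-comm 2 _)) (∣n⇒∣m*n 171 (∣m⇒∣m*n (A k) d∣A)))
                    (∣n⇒∣m*n 169 (∣m⇒∣m*n (B k) d∣B))

  1<A-suc : ∀ k → 1 < A (suc k)
  1<A-suc k = begin-strict
    1                        <⟨ s≤s (s≤s z≤n) ⟩
    170 * 1                  ≤⟨ *-monoʳ-≤ 170 (odd⇒0< (proj₁ (odd-A×odd-B k))) ⟩
    170 * A k                ≤⟨ m≤m+n _ _ ⟩
    170 * A k + 169 * B k    ≡⟨ A-suc k ⟨
    A (suc k)                ∎
    where open ≤-Reasoning

  y-factorisation : ∀ e k → ∃[ R ] (y (2 ^ e * (k + suc k)) ≡ 39 * (A k * B k) * R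
                                    × Coprime (A k) (B k * R) × Coprime (B k) (A k * R))
  y-factorisation e k = factorise (y[2^e*m]≡y[m]*R e (k + suc k) coprime-y-2)
    where
    coprime-y-2 : Coprime (y (k + suc k)) 2
    coprime-y-2 = Coprimality.sym (subst (Coprime 2) (sym (y-odd k))
      (coprime-* (from-yes (coprime? 2 39))
                 (coprime-* (odd⇒coprime-2 (proj₁ (odd-A×odd-B k))) (odd⇒coprime-2 (proj₂ (odd-A×odd-B k))))))
    A∣y : A k ∣ y (k + suc k)
    A∣y = subst (A k ∣_) (sym (y-odd k)) (∣n⇒∣m*n 39 (m∣m*n (B k)))
    B∣y : B k ∣ y (k + suc k)
    B∣y = subst (B k ∣_) (sym (y-odd k)) (∣n⇒∣m*n 39 (n∣m*n (A k)))
    factorise : ∃[ R ] (y (2 ^ e * (k + suc k)) ≡ y (k + suc k) * R × Coprime (y (k + suc k)) R) →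
      ∃[ R ] (y (2 ^ e * (k + suc k)) ≡ 39 * (A k * B k) * R × Coprime (A k) (B k * R) × Coprime (B k) (A k * R))
    factorise (R , y≡ , coprime-R) = R , trans y≡ (cong (_* R) (y-odd k))
      , coprime-* (coprime-A-B k) (divisor-coprime A∣y)
      , coprime-* (Coprimality.sym (coprime-A-B k)) (divisor-coprime B∣y)
      where
      divisor-coprime : ∀ {a} → a ∣ y (k + suc k) → Coprime a R
      divisor-coprime a∣y (d∣a , d∣R) = coprime-R (∣-trans d∣a a∣y , d∣R)

  even-or-odd : ∀ n → ∃[ h ] (n ≡ h + h ⊎ n ≡ h + suc h)
  even-or-odd zero = 0 , inj₁ refl
  even-or-odd (suc n) with even-or-odd n
  ... | h , inj₁ n≡h+h = h , inj₂ (trans (cong suc n≡h+h) (sym (+-suc h h)))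
  ... | h , inj₂ n≡h+1+h = suc h , inj₁ (cong suc n≡h+1+h)

  OddPart : ℕ → Set
  OddPart n = ∃[ e ] ∃[ k ] n ≡ 2 ^ e * (k + suc k)

  odd-part : ∀ n → 0 < n → OddPart n
  odd-part = <-rec (λ n → 0 < n → OddPart n) split
    where
    split : ∀ n → (∀ {m} → m < n → 0 < m → OddPart m) → 0 < n → OddPart n
    split n ih 0<n with even-or-odd n
    ... | h , inj₂ n≡ = 0 , h , trans n≡ (sym (+-identityʳ _))
    ... | zero , inj₁ refl = ⊥-elim (<-irrefl refl 0<n)
    ... | h@(suc _) , inj₁ refl with ih (m<m+n h (s≤s z≤n)) (s≤s z≤n)
    ...   | e , k , h≡ = suc e , k , trans (cong₂ _+_ h≡ h≡) (double (2 ^ e) (k + suc k))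
      where
      double : ∀ a b → a * b + a * b ≡ 2 * a * b
      double = solve-∀

  isPellEnumeration⇒≗y : ∀ {X Y} → IsPellEnumeration X Y → ∀ k → Y k ≡ y k
  isPellEnumeration⇒≗y {X} {Y} (sol , Y↑ , complete) =
    strictlyIncreasing-same-range⇒≗ Y↑ y-increasing
      (λ i → let j , _ , Yi≡yj = pellSol⇒inPellSequence (Y i) (X i) (sol i) in j , Yi≡yj)
      (λ j → let i , _ , yj≡Yi = complete (x j) (y j) (pellSol-x-y j) in i , yj≡Yi)

open QuadraticForm using (ValueOfQ; coprime-factors-of-value)
open PellEquation using (y; A; B; isPellEnumeration⇒≗y; odd-part; y-factorisation; A-B-norm; odd-A×odd-B; odd⇒0<; 1<A-suc)
open import Data.Nat.DivMod using (m*n/n≡m)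
import Data.Nat.Tactic.RingSolver as ℕ-Ring
open import Data.Integer as ℤ using (ℤ; +_; -_; _+_; _*_; _-_)
import Data.Integer.Properties as ℤP
open import Data.Integer.Divisibility using (_∣_)
open import Data.Integer.Tactic.RingSolver using (solve-∀)

39abc/39≡abc : ∀ a b c {m} → m ≡ 39 ℕ.* (a ℕ.* b) ℕ.* c → m / 39 ≡ a ℕ.* (b ℕ.* c)
39abc/39≡abc a b c m≡ = trans (cong (_/ 39) (trans m≡ (regroup a b c))) (m*n/n≡m (a ℕ.* (b ℕ.* c)) 39)
  where
  regroup : ∀ a b c → 39 ℕ.* (a ℕ.* b) ℕ.* c ≡ a ℕ.* (b ℕ.* c) ℕ.* 39
  regroup = ℕ-Ring.solve-∀

39ab∣39abc : ∀ a b c → + 39 * + a * + b ∣ + (39 ℕ.* (a ℕ.* b) ℕ.* c)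
39ab∣39abc a b c = subst (λ z → ℤ.∣ z ∣ ℕD.∣ 39 ℕ.* (a ℕ.* b) ℕ.* c) 39ab≡ (ℕD.m∣m*n c)
  where
  39ab≡ : + (39 ℕ.* (a ℕ.* b)) ≡ + 39 * + a * + b
  39ab≡ = trans (ℤP.pos-* 39 (a ℕ.* b)) (trans (cong (+ 39 *_) (ℤP.pos-* a b)) (sym (ℤP.*-assoc (+ 39) (+ a) (+ b))))

norm-equation-ℤ : ∀ a b → 171 ℕ.* (a ℕ.* a) ≡ 2 ℕ.+ 169 ℕ.* (b ℕ.* b) →
  + 19 * + 9 * (+ a * + a) - + 169 * (+ b * + b) ≡ + 2
norm-equation-ℤ a b eq = begin
  + 171 * (+ a * + a) - 169b²                 ≡⟨ cong (λ z → + 171 * z - 169b²) (ℤP.pos-* a a) ⟨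
  + 171 * + (a ℕ.* a) - 169b²                 ≡⟨ cong (_- 169b²) (ℤP.pos-* 171 (a ℕ.* a)) ⟨
  + (171 ℕ.* (a ℕ.* a)) - 169b²               ≡⟨ cong (λ z → + z - 169b²) eq ⟩
  + (2 ℕ.+ 169 ℕ.* (b ℕ.* b)) - 169b²         ≡⟨ cong (_- 169b²) 2+169b²≡ ⟩
  + 2 + 169b² - 169b²                         ≡⟨ cancel (+ 2) 169b² ⟩
  + 2                                         ∎
  where
  open ≡-Reasoning
  169b² : ℤ
  169b² = + 169 * (+ b * + b)
  2+169b²≡ : + (2 ℕ.+ 169 ℕ.* (b ℕ.* b)) ≡ + 2 + 169b²
  2+169b²≡ = trans (ℤP.pos-+ 2 (169 ℕ.* (b ℕ.* b))) (cong (_+_ (+ 2)) (trans (ℤP.pos-* 169 (b ℕ.* b)) (cong (+ 169 *_) (ℤP.pos-* b b))))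
  cancel : ∀ c d → c + d - d ≡ c
  cancel = solve-∀

Q[±1,0]≡1 : ∀ {r s} → (r ≡ + 1 ⊎ r ≡ - + 1) × s ≡ + 0 → Q r s ≡ + 1
Q[±1,0]≡1 (inj₁ refl , refl) = refl
Q[±1,0]≡1 (inj₂ refl , refl) = refl

values⇒solution : ∀ a b m → 171 ℕ.* (a ℕ.* a) ≡ 2 ℕ.+ 169 ℕ.* (b ℕ.* b) → 1 < a →
  + 39 * + a * + b ∣ + m → ValueOfQ (+ a) → ValueOfQ (+ b) →
  ∃[ r ] ∃[ s ] ∃[ v ] ∃[ u ]
    ((+ 19 * + 9 * (Q r s * Q r s) - + 169 * (Q v u * Q v u) ≡ + 2) ×
     ¬ ((r ≡ + 1 ⊎ r ≡ - + 1) × s ≡ + 0) ×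
     (+ 39 * Q r s * Q v u ∣ + m))
values⇒solution a b m norm 1<a 39ab∣m (r , s , a≡Q) (v , u , b≡Q) = r , s , v , u
  , subst₂ (λ i j → + 19 * + 9 * (i * i) - + 169 * (j * j) ≡ + 2) a≡Q b≡Q (norm-equation-ℤ a b norm)
  , (λ r,s≡±1,0 → ℕP.<⇒≢ 1<a (sym (ℤP.+-injective (trans a≡Q (Q[±1,0]≡1 r,s≡±1,0)))))
  , subst₂ (λ i j → + 39 * i * j ∣ + m) a≡Q b≡Q 39ab∣m

corollary1 : (X Y : ℕ → ℕ) → IsPellEnumeration X Y →
    (n : ℕ) → 0 < n → ¬ IsPowerOf2 n → Representable (Y n / 39) →
    ∃[ r ] ∃[ s ] ∃[ v ] ∃[ u ]
      ((+ 19 * + 9 * (Q r s * Q r s) - + 169 * (Q v u * Q v u) ≡ + 2) ×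
       ¬ ((r ≡ + 1 ⊎ r ≡ - + 1) × s ≡ + 0) ×
       (+ 39 * Q r s * Q v u ∣ + Y n))
corollary1 X Y enumeration n 0<n not-power (_ , value) with odd-part n 0<n
... | e , zero , n≡2^e = ⊥-elim (not-power (e , trans n≡2^e (ℕP.*-identityʳ (2 ℕ.^ e))))
... | e , k@(suc k₀) , n≡ = values⇒solution (A k) (B k) (Y n) (A-B-norm k) (1<A-suc k₀)
      (subst (λ m → + 39 * + A k * + B k ∣ + m) (sym Yn≡39ABR) (39ab∣39abc (A k) (B k) R))
      (proj₁ values) (proj₂ values)
  where
  R : ℕ
  R = proj₁ (y-factorisation e k)
  Yn≡39ABR : Y n ≡ 39 ℕ.* (A k ℕ.* B k) ℕ.* R
  Yn≡39ABR = trans (isPellEnumeration⇒≗y enumeration n) (trans (cong y n≡) (proj₁ (proj₂ (y-factorisation e k))))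
  values : ValueOfQ (+ A k) × ValueOfQ (+ B k)
  values = coprime-factors-of-value (odd⇒0< (proj₁ (odd-A×odd-B k))) (odd⇒0< (proj₂ (odd-A×odd-B k)))
    (proj₁ (proj₂ (proj₂ (y-factorisation e k)))) (proj₂ (proj₂ (proj₂ (y-factorisation e k))))
    (subst (λ m → ValueOfQ (+ m)) (39abc/39≡abc (A k) (B k) R Yn≡39ABR) value)
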